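{- Let $k\ge 0$ and let the vertices of the path $P_{3k+2}$ be labeled $1,2,\ldots,3k+2$ consecutively along the path. Then $\tau(P_{3k+2})=k+2$, and for each vertex $v$, writing $v=3q+r$ with integers $q\ge 0$ and $0\le r<3$, $$DV_{P_{3k+2}}(v)=\begin{cases}0 & \text{if } v\equiv 0\pmod 3,\\ 1+q & \text{if } v\equiv 1\pmod 3,\\ k+1-q & \text{if } v\equiv 2\pmod 3.\end{cases}$$
   Context: All graphs are finite, simple and undirected. A set $D\subseteq V(G)$ is a dominating set of $G$ if every vertex not in $D$ is adjacent to at least one vertex of $D$. The domination number $\gamma(G)$ is the minimum cardinality of a dominating set; a dominating set of cardinality $\gamma(G)$ is a $\gamma(G)$-set. $\tau(G)$ denotes the total number of $\gamma(G)$-sets, and for $v\in V(G)$, $DV_G(v)$ is the number of $\gamma(G)$-sets containing $v$. -}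

module Defs where

open import Data.Nat using (ℕ; zero; suc; _+_; _≡ᵇ_; _≤ᵇ_)
open import Data.Nat.Properties using (≡ᵇ⇒≡)
open import Data.Bool using (Bool; true; false; _∧_; _∨_; not; T)
open import Data.Fin using (Fin; toℕ)
open import Data.Fin.Subset using (Subset; ∣_∣)
open import Data.List using (List; []; _∷_; map; _++_; filter; length; allFin)
open import Data.Bool.ListAction using (all; any)
open import Data.Vec using (Vec; []; _∷_; lookup)
open import Data.Bool.Properties using (T?)
open import Relation.Binary.PropositionalEquality using (_≡_; refl)

record Graph (n : ℕ) : Set where
  field
    adj     : Fin n → Fin n → Bool
    adj-sym : ∀ u v → adj u v ≡ adj v u
    adj-irr : ∀ v → adj v v ≡ false
open Graph public

allSubsets : (n : ℕ) → List (Subset n)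
allSubsets zero    = [] ∷ []
allSubsets (suc n) = map (true ∷_) (allSubsets n) ++ map (false ∷_) (allSubsets n)

module _ {n : ℕ} (G : Graph n) where

  isDominating : Subset n → Bool
  isDominating D = all (λ v → lookup D v ∨ any (λ u → lookup D u ∧ adj G u v) (allFin n)) (allFin n)

  isGammaSet : Subset n → Bool
  isGammaSet D = isDominating D ∧ all (λ D' → not (isDominating D') ∨ (∣ D ∣ ≤ᵇ ∣ D' ∣)) (allSubsets n)

  gammaSets : List (Subset n)
  gammaSets = filter (λ D → T? (isGammaSet D)) (allSubsets n)

  τ : ℕ
  τ = length gammaSets

  DV : Fin n → ℕ
  DV v = length (filter (λ D → T? (lookup D v)) gammaSets)

-- the path P_n on Fin n: vertex i (label toℕ i + 1) adjacent to vertex j iff |i - j| = 1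
pathAdj : {n : ℕ} → Fin n → Fin n → Bool
pathAdj i j = (suc (toℕ i) ≡ᵇ toℕ j) ∨ (suc (toℕ j) ≡ᵇ toℕ i)

pathAdj-sym : {n : ℕ} (i j : Fin n) → pathAdj i j ≡ pathAdj j i
pathAdj-sym i j with suc (toℕ i) ≡ᵇ toℕ j | suc (toℕ j) ≡ᵇ toℕ i
... | true  | true  = refl
... | true  | false = refl
... | false | true  = refl
... | false | false = refl

private
  sn≢n : ∀ m → (suc m ≡ᵇ m) ≡ false
  sn≢n zero    = refl
  sn≢n (suc m) = sn≢n m

pathAdj-irr : {n : ℕ} (i : Fin n) → pathAdj i i ≡ false
pathAdj-irr i rewrite sn≢n (toℕ i) = refl

P : (n : ℕ) → Graph n
P n = record { adj = pathAdj ; adj-sym = pathAdj-sym ; adj-irr = pathAdj-irr }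

module Submission where

open import Defs
open import Data.Nat using (ℕ; zero; suc; _+_; _*_; _∸_; _/_; _%_; _≤_; _<_; NonZero; z≤n; s≤s; s≤s⁻¹; _≤ᵇ_; _<ᵇ_; _≡ᵇ_)
open import Data.Nat.Properties using (≤-refl; ≤-trans; ≤-reflexive; ≤ᵇ⇒≤; ≤⇒≤ᵇ; <-≤-trans; ≤-<-trans; <-irrefl; n≤1+n; +-monoˡ-≤; +-comm; *-comm; 0∸n≡0; *-cancelʳ-<)
open import Data.Nat.DivMod using (/-monoˡ-≤; m/n≡1+[m∸n]/n; m*n/n≡m; m<n⇒m/n≡0; +-distrib-/-∣ʳ; [m+kn]%n≡m%n; _divMod_; result)
open import Data.Nat.Divisibility using (divides-refl)
open import Data.Bool using (Bool; true; false; _∧_; _∨_; not; T)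
open import Data.Bool.Properties using (T?; T-∧; T-≡; ⇔→≡; ∧-zeroʳ; ∧-identityʳ; ∨-identityʳ)
open import Data.Fin using (Fin; toℕ; zero; suc)
open import Data.Fin.Properties using (toℕ<n)
open import Data.Fin.Subset using (Subset; ∣_∣)
open import Data.List using (List; []; _∷_; map; _++_; length; tabulate; allFin; filterᵇ)
open import Data.List.Properties using (filter-++; filter-≐; filter-none; filter-all; filter-accept; filter-reject; map-tabulate; map-cong; ++-identityʳ; map-∘; length-map)
open import Data.List.Membership.Propositional using (_∈_)
open import Data.List.Relation.Unary.Any using (here)
open import Data.List.Membership.Propositional.Properties using (∈-map⁺; ∈-++⁺ˡ; ∈-++⁺ʳ)
open import Data.List.Relation.Unary.All as All using (All)
open import Data.List.Relation.Unary.All.Properties using (all⁺; all⁻)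
open import Data.Bool.ListAction using (all; any; and; or)
open import Data.Vec using (Vec; []; _∷_; lookup)
open import Data.Product using (_×_; _,_; proj₁; proj₂)
open import Data.Unit using (tt)
open import Function using (_∘_; _⇔_; mk⇔; Equivalence)
open import Relation.Nullary using (¬_; contradiction)
open import Relation.Binary.PropositionalEquality using (_≡_; refl; sym; trans; cong; cong₂; subst; module ≡-Reasoning)

-- Scanning a subset of a path from left to right, one only has to remember whether the last
-- vertex is chosen, dominated by an earlier choice, or still undominated; this three-state scan
-- decides domination. As a chosen vertex dominates at most three vertices, a scan cannot succeed
-- with fewer than about a third of the remaining vertices chosen, which gives γ(P_{3k+2}) = k + 1.
-- Unfolding the scan with budget k + 1 letter by letter lists the γ-sets explicitly as the k + 2
-- sets {2, 5, …, 3j − 1} ∪ {3j + 1, …, 3k + 1} (0 ≤ j ≤ k + 1), and DV(v) counts the j with v in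
-- the j-th set.

private variable
  A B : Set
  m n p : ℕ

filterᵇ-cong : {p q : A → Bool} → (∀ x → p x ≡ q x) → (xs : List A) → filterᵇ p xs ≡ filterᵇ q xs
filterᵇ-cong p≗q = filter-≐ (T? ∘ _) (T? ∘ _)
  ((λ {x} → subst T (p≗q x)) , (λ {x} → subst T (sym (p≗q x))))

filterᵇ-map : (p : B → Bool) (f : A → B) (xs : List A) → filterᵇ p (map f xs) ≡ map f (filterᵇ (p ∘ f) xs)
filterᵇ-map p f [] = refl
filterᵇ-map p f (x ∷ xs) with p (f x)
... | true  = cong (f x ∷_) (filterᵇ-map p f xs)
... | false = filterᵇ-map p f xs

filterᵇ-false : (xs : List A) → filterᵇ (λ _ → false) xs ≡ []
filterᵇ-false xs = filter-none (T? ∘ _) (All.universal (λ _ ()) xs)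

filterᵇ-true : (xs : List A) → filterᵇ (λ _ → true) xs ≡ xs
filterᵇ-true xs = filter-all (T? ∘ _) (All.universal _ xs)

∈-allSubsets : (x : Subset n) → x ∈ allSubsets n
∈-allSubsets []          = here refl
∈-allSubsets (true ∷ x)  = ∈-++⁺ˡ (∈-map⁺ (true ∷_) (∈-allSubsets x))
∈-allSubsets (false ∷ x) = ∈-++⁺ʳ (map (true ∷_) (allSubsets _)) (∈-map⁺ (false ∷_) (∈-allSubsets x))

solutions : (m : ℕ) → (Vec Bool m → Bool) → List (Vec Bool m)
solutions m p = filterᵇ p (allSubsets m)

solutions-split : (p : Vec Bool (suc m) → Bool) →
  solutions (suc m) p ≡
  map (true ∷_) (solutions m (p ∘ (true ∷_))) ++ map (false ∷_) (solutions m (p ∘ (false ∷_)))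
solutions-split {m} p = trans (filter-++ (T? ∘ p) (map (true ∷_) S) (map (false ∷_) S))
  (cong₂ _++_ (filterᵇ-map p (true ∷_) S) (filterᵇ-map p (false ∷_) S))
  where S = allSubsets m

solutions-by-head : {p : Vec Bool (suc m) → Bool} {xs ys : List (Vec Bool m)} →
  solutions m (p ∘ (true ∷_)) ≡ xs → solutions m (p ∘ (false ∷_)) ≡ ys →
  solutions (suc m) p ≡ map (true ∷_) xs ++ map (false ∷_) ys
solutions-by-head {p = p} refl refl = solutions-split p

solutions-none : {p : Vec Bool m → Bool} → (∀ x → ¬ T (p x)) → solutions m p ≡ []
solutions-none {m} p-false = filter-none (T? ∘ _) (All.universal p-false (allSubsets m))

solutions-forced : {p : Vec Bool (suc m) → Bool} → (∀ x → ¬ T (p (false ∷ x))) →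
  solutions (suc m) p ≡ map (true ∷_) (solutions m (p ∘ (true ∷_)))
solutions-forced {m} {p} p-false = begin
  solutions (suc m) p                                 ≡⟨ solutions-split p ⟩
  map (true ∷_) S₁ ++ map (false ∷_) (solutions m _) ≡⟨ cong (λ ys → map (true ∷_) S₁ ++ map (false ∷_) ys)
                                                             (solutions-none p-false) ⟩
  map (true ∷_) S₁ ++ []                              ≡⟨ ++-identityʳ _ ⟩
  map (true ∷_) S₁                                    ∎
  where
  open ≡-Reasoning
  S₁ = solutions m (p ∘ (true ∷_))

T-all-allSubsets : {p : Vec Bool n → Bool} → T (all p (allSubsets n)) ⇔ (∀ x → T (p x))
T-all-allSubsets {n} {p} = mk⇔ (λ t x → All.lookup (all⁺ p (allSubsets n) t) (∈-allSubsets x))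
                               (λ h → all⁻ p {allSubsets n} (All.tabulate (λ {x} _ → h x)))

T-not-∨ : {b c : Bool} → T (not b ∨ c) ⇔ (T b → T c)
T-not-∨ {true}  = mk⇔ (λ t _ → t) (λ h → h tt)
T-not-∨ {false} = mk⇔ (λ _ ()) (λ _ → tt)

T-⇔⇒≡ : {b c : Bool} → T b ⇔ T c → b ≡ c
T-⇔⇒≡ h = ⇔→≡ {z = true}
  (mk⇔ (λ e → to T-≡ (to h (from T-≡ e))) (λ e → to T-≡ (from h (from T-≡ e))))
  where open Equivalence

module _ (G : Graph n) where
  open Equivalence

  T-isGammaSet : (D : Subset n) → T (isGammaSet G D) ⇔
    (T (isDominating G D) × (∀ D′ → T (isDominating G D′) → ∣ D ∣ ≤ ∣ D′ ∣))
  T-isGammaSet D = mk⇔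
    (λ t → let dom , min = to T-∧ t in
      dom , λ D′ dom′ → ≤ᵇ⇒≤ _ _ (to T-not-∨ (to T-all-allSubsets min D′) dom′))
    (λ (dom , min) → from T-∧
      (dom , from T-all-allSubsets (λ D′ → from T-not-∨ (λ dom′ → ≤⇒≤ᵇ (min D′ dom′)))))

  isGammaSet≡ : (γ : ℕ) → (∀ D → T (isDominating G D) → γ ≤ ∣ D ∣) →
    (W : Subset n) → T (isDominating G W) → ∣ W ∣ ≤ γ →
    (D : Subset n) → isGammaSet G D ≡ isDominating G D ∧ (∣ D ∣ ≤ᵇ γ)
  isGammaSet≡ γ γ≤ W W-dom W≤γ D = T-⇔⇒≡ (mk⇔
    (λ t → let dom , min = to (T-isGammaSet D) t in
      from T-∧ (dom , ≤⇒≤ᵇ (≤-trans (min W W-dom) W≤γ)))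
    (λ t → let dom , D≤γ = to T-∧ t in
      from (T-isGammaSet D) (dom , λ D′ dom′ → ≤-trans (≤ᵇ⇒≤ _ _ D≤γ) (γ≤ D′ dom′))))

-- Domination on paths

infixl 10 _!_
_!_ : Vec Bool n → ℕ → Bool
[]      ! _     = false
(b ∷ _) ! zero  = b
(_ ∷ D) ! suc w = D ! w

lookup-! : (D : Vec Bool n) (i : Fin n) → lookup D i ≡ D ! toℕ i
lookup-! (b ∷ D) zero    = refl
lookup-! (b ∷ D) (suc i) = lookup-! D i

allBelow anyBelow : ℕ → (ℕ → Bool) → Bool
allBelow zero    F = true
allBelow (suc n) F = F 0 ∧ allBelow n (F ∘ suc)
anyBelow zero    F = false
anyBelow (suc n) F = F 0 ∨ anyBelow n (F ∘ suc)

and-tabulate : ∀ n (F : ℕ → Bool) → and (tabulate {n = n} (F ∘ toℕ)) ≡ allBelow n F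
and-tabulate zero    F = refl
and-tabulate (suc n) F = cong (F 0 ∧_) (and-tabulate n (F ∘ suc))

or-tabulate : ∀ n (F : ℕ → Bool) → or (tabulate {n = n} (F ∘ toℕ)) ≡ anyBelow n F
or-tabulate zero    F = refl
or-tabulate (suc n) F = cong (F 0 ∨_) (or-tabulate n (F ∘ suc))

all-allFin : ∀ n (F : ℕ → Bool) → all (F ∘ toℕ) (allFin n) ≡ allBelow n F
all-allFin n F = trans (cong and (map-tabulate {n = n} (λ i → i) (F ∘ toℕ))) (and-tabulate n F)

any-allFin : ∀ n (F : ℕ → Bool) → any (F ∘ toℕ) (allFin n) ≡ anyBelow n F
any-allFin n F = trans (cong or (map-tabulate {n = n} (λ i → i) (F ∘ toℕ))) (or-tabulate n F)

anyBelow-false : ∀ n {F : ℕ → Bool} → (∀ a → F a ≡ false) → anyBelow n F ≡ false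
anyBelow-false zero    F≡false = refl
anyBelow-false (suc n) F≡false = cong₂ _∨_ (F≡false 0) (anyBelow-false n (F≡false ∘ suc))

adjacent : ℕ → ℕ → Bool
adjacent a w = (suc a ≡ᵇ w) ∨ (suc w ≡ᵇ a)

anyBelow-first : (D : Vec Bool n) → anyBelow n (λ a → D ! a ∧ (0 ≡ᵇ a)) ≡ D ! 0
anyBelow-first []      = refl
anyBelow-first {suc n} (b ∷ D) = trans (cong ((b ∧ true) ∨_) (anyBelow-false n (λ a → ∧-zeroʳ (D ! a))))
                               (trans (∨-identityʳ _) (∧-identityʳ b))

anyBelow-adjacent : (D : Vec Bool n) (w : ℕ) →
  anyBelow n (λ a → D ! a ∧ adjacent a w) ≡ (false ∷ D) ! w ∨ D ! suc w
anyBelow-adjacent []      zero          = refl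
anyBelow-adjacent []      (suc w)       = refl
anyBelow-adjacent (b ∷ D) zero          = cong₂ _∨_ (∧-zeroʳ b) (anyBelow-first D)
anyBelow-adjacent (b ∷ D) (suc zero)    = cong₂ _∨_ (∧-identityʳ b) (anyBelow-adjacent D 0)
anyBelow-adjacent (b ∷ D) (suc (suc w)) = cong₂ _∨_ (∧-zeroʳ b) (anyBelow-adjacent D (suc w))

-- l is the membership of the vertex just before D, so that (l ∷ D) ! w is the left neighbour of w.
dominatedAt : Bool → Vec Bool n → ℕ → Bool
dominatedAt l D w = D ! w ∨ ((l ∷ D) ! w ∨ D ! suc w)

isDominating-P≡allBelow : (D : Subset n) → isDominating (P n) D ≡ allBelow n (dominatedAt false D)
isDominating-P≡allBelow {n} D = trans (cong and (map-cong vertex (allFin n))) (all-allFin n (dominatedAt false D))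
  where
  vertex : (v : Fin n) →
    (lookup D v ∨ any (λ u → lookup D u ∧ pathAdj u v) (allFin n)) ≡ dominatedAt false D (toℕ v)
  vertex v = cong₂ _∨_ (lookup-! D v) (begin
    or (map (λ u → lookup D u ∧ pathAdj u v) (allFin n))
      ≡⟨ cong or (map-cong (λ u → cong (_∧ pathAdj u v) (lookup-! D u)) (allFin n)) ⟩
    any ((λ a → D ! a ∧ adjacent a (toℕ v)) ∘ toℕ) (allFin n)
      ≡⟨ any-allFin n _ ⟩
    anyBelow n (λ a → D ! a ∧ adjacent a (toℕ v))
      ≡⟨ anyBelow-adjacent D (toℕ v) ⟩
    (false ∷ D) ! toℕ v ∨ D ! suc (toℕ v) ∎)
    where open ≡-Reasoning

data State : Set where
  chosen dominated undominated : State

prevChosen prevDominated : State → Bool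
prevChosen chosen = true
prevChosen _      = false
prevDominated undominated = false
prevDominated _           = true

dominatesFrom : State → Vec Bool n → Bool
dominatesFrom s           []          = prevDominated s
dominatesFrom _           (true ∷ D)  = dominatesFrom chosen D
dominatesFrom chosen      (false ∷ D) = dominatesFrom dominated D
dominatesFrom dominated   (false ∷ D) = dominatesFrom undominated D
dominatesFrom undominated (false ∷ D) = false

dominatesFrom-dominatedAt : (s : State) (D : Vec Bool n) →
  dominatesFrom s D ≡ (prevDominated s ∨ D ! 0) ∧ allBelow n (dominatedAt (prevChosen s) D)
dominatesFrom-dominatedAt chosen      []          = refl
dominatesFrom-dominatedAt dominated   []          = refl
dominatesFrom-dominatedAt undominated []          = refl
dominatesFrom-dominatedAt chosen      (true ∷ D)  = dominatesFrom-dominatedAt chosen D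
dominatesFrom-dominatedAt dominated   (true ∷ D)  = dominatesFrom-dominatedAt chosen D
dominatesFrom-dominatedAt undominated (true ∷ D)  = dominatesFrom-dominatedAt chosen D
dominatesFrom-dominatedAt chosen      (false ∷ D) = dominatesFrom-dominatedAt dominated D
dominatesFrom-dominatedAt dominated   (false ∷ D) = dominatesFrom-dominatedAt undominated D
dominatesFrom-dominatedAt undominated (false ∷ D) = refl

isDominating-P≡dominatesFrom : (D : Subset n) → isDominating (P n) D ≡ dominatesFrom dominated D
isDominating-P≡dominatesFrom D = trans (isDominating-P≡allBelow D) (sym (dominatesFrom-dominatedAt dominated D))

dominatesWithin : State → Vec Bool n → ℕ → Bool
dominatesWithin s           []          b       = prevDominated s
dominatesWithin _           (true ∷ D)  zero    = false
dominatesWithin _           (true ∷ D)  (suc b) = dominatesWithin chosen D b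
dominatesWithin chosen      (false ∷ D) b       = dominatesWithin dominated D b
dominatesWithin dominated   (false ∷ D) b       = dominatesWithin undominated D b
dominatesWithin undominated (false ∷ D) b       = false

<ᵇ-suc : ∀ m n → (m <ᵇ suc n) ≡ (m ≤ᵇ n)
<ᵇ-suc zero    n = refl
<ᵇ-suc (suc m) n = refl

dominatesWithin≡ : (s : State) (D : Vec Bool n) (b : ℕ) →
  dominatesWithin s D b ≡ dominatesFrom s D ∧ (∣ D ∣ ≤ᵇ b)
dominatesWithin≡ chosen      []          b       = refl
dominatesWithin≡ dominated   []          b       = refl
dominatesWithin≡ undominated []          b       = refl
dominatesWithin≡ s           (true ∷ D)  zero    = sym (∧-zeroʳ _)
dominatesWithin≡ s           (true ∷ D)  (suc b) =
  trans (dominatesWithin≡ chosen D b) (cong (dominatesFrom chosen D ∧_) (sym (<ᵇ-suc ∣ D ∣ b)))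
dominatesWithin≡ chosen      (false ∷ D) b       = dominatesWithin≡ dominated D b
dominatesWithin≡ dominated   (false ∷ D) b       = dominatesWithin≡ undominated D b
dominatesWithin≡ undominated (false ∷ D) b       = refl

isDominating-P∧≤ᵇ : (D : Subset n) (b : ℕ) →
  isDominating (P n) D ∧ (∣ D ∣ ≤ᵇ b) ≡ dominatesWithin dominated D b
isDominating-P∧≤ᵇ D b =
  trans (cong (_∧ (∣ D ∣ ≤ᵇ b)) (isDominating-P≡dominatesFrom D)) (sym (dominatesWithin≡ dominated D b))

offset : State → ℕ
offset chosen      = 1
offset dominated   = 2
offset undominated = 3

-- A chosen vertex dominates at most three consecutive vertices, so after a chosen, dominated or
-- undominated vertex, n more vertices need at least ⌈(n − 1)/3⌉, ⌈n/3⌉ or ⌈(n + 1)/3⌉ chosen ones.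
required : State → ℕ → ℕ
required s n = (offset s + n) / 3

offset≤3 : ∀ s → offset s ≤ 3
offset≤3 chosen      = s≤s z≤n
offset≤3 dominated   = s≤s (s≤s z≤n)
offset≤3 undominated = ≤-refl

required-choose : ∀ s n → required s (suc n) ≤ suc (required chosen n)
required-choose s n = ≤-trans (/-monoˡ-≤ 3 (+-monoˡ-≤ (suc n) (offset≤3 s)))
                              (≤-reflexive (m/n≡1+[m∸n]/n {3 + suc n} {3} (s≤s (s≤s (s≤s z≤n)))))

required≤budget : ∀ s (D : Vec Bool n) b → T (dominatesWithin s D b) → required s n ≤ b
required≤budget chosen      []          b       _ = z≤n
required≤budget dominated   []          b       _ = z≤n
required≤budget s           (true ∷ D)  (suc b) t =
  ≤-trans (required-choose s _) (s≤s (required≤budget chosen D b t))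
required≤budget chosen      (false ∷ D) b       t = required≤budget dominated D b t
required≤budget dominated   (false ∷ D) b       t = required≤budget undominated D b t

solutions-below-required : ∀ s {b} → b < required s m → solutions m (λ D → dominatesWithin s D b) ≡ []
solutions-below-required s {b} b<req =
  solutions-none (λ D t → <-irrefl refl (≤-<-trans (required≤budget s D b t) b<req))

-- The γ-sets of P_{3k+2}

k<[3+3k]/3 : ∀ k → k < (3 + k * 3) / 3
k<[3+3k]/3 k = ≤-reflexive (sym (m*n/n≡m (suc k) 3))

k<[4+3k]/3 : ∀ k → k < (4 + k * 3) / 3
k<[4+3k]/3 k = ≤-trans (k<[3+3k]/3 k) (/-monoˡ-≤ 3 (n≤1+n (3 + k * 3)))

thirds : (k : ℕ) → Vec Bool (suc (k * 3))
thirds zero    = false ∷ []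
thirds (suc k) = false ∷ false ∷ true ∷ thirds k

prefix010 : Vec Bool n → Vec Bool (3 + n)
prefix010 w = false ∷ true ∷ false ∷ w

-- With vertices labelled 1, …, 3k+2, the j-th word (j = 0, …, k+1) is the set
-- {2, 5, …, 3j−1} ∪ {3j+1, 3j+4, …, 3k+1}.
γWords : (k : ℕ) → List (Vec Bool (2 + k * 3))
γWords zero    = (true ∷ false ∷ []) ∷ (false ∷ true ∷ []) ∷ []
γWords (suc k) = (true ∷ thirds (suc k)) ∷ map prefix010 (γWords k)

length-γWords : ∀ k → length (γWords k) ≡ 2 + k
length-γWords zero    = refl
length-γWords (suc k) = cong suc (trans (length-map _ (γWords k)) (length-γWords k))

solutions-thirds : ∀ k → solutions (suc (k * 3)) (λ D → dominatesWithin chosen D k) ≡ thirds k ∷ []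
solutions-thirds zero    = refl
solutions-thirds (suc k) =
  solutions-by-head (solutions-below-required chosen (k<[4+3k]/3 k))
    (solutions-by-head (solutions-below-required chosen (k<[3+3k]/3 k))
      (trans (solutions-forced (λ _ ())) (cong (map (true ∷_)) (solutions-thirds k))))

solutions-γWords : ∀ k → solutions (2 + k * 3) (λ D → dominatesWithin dominated D (suc k)) ≡ γWords k
solutions-γWords zero    = refl
solutions-γWords (suc k) = trans
  (solutions-by-head (solutions-thirds (suc k))
    (trans (solutions-forced (λ _ ())) (cong (map (true ∷_))
      (solutions-by-head (solutions-below-required chosen (k<[3+3k]/3 k)) (solutions-γWords k)))))
  (cong ((true ∷ thirds (suc k)) ∷_)
    (sym (trans (map-∘ {g = false ∷_} (γWords k)) (cong (map (false ∷_)) (map-∘ (γWords k))))))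

T-dominatesWithin : (D : Subset n) (b : ℕ) →
  T (dominatesWithin dominated D b) ⇔ (T (isDominating (P n) D) × ∣ D ∣ ≤ b)
T-dominatesWithin D b = mk⇔
  (λ t → let dom , small = to T-∧ (subst T (sym (isDominating-P∧≤ᵇ D b)) t) in dom , ≤ᵇ⇒≤ _ _ small)
  (λ (dom , D≤b) → subst T (isDominating-P∧≤ᵇ D b) (from T-∧ (dom , ≤⇒≤ᵇ D≤b)))
  where open Equivalence

thirds-dominates : ∀ k → T (dominatesWithin chosen (thirds k) k)
thirds-dominates zero    = tt
thirds-dominates (suc k) = thirds-dominates k

isGammaSet-P : ∀ k (D : Subset (2 + k * 3)) → isGammaSet (P (2 + k * 3)) D ≡ dominatesWithin dominated D (suc k)
isGammaSet-P k D = trans (isGammaSet≡ (P _) (suc k) γ≤ W W-dom W≤γ D) (isDominating-P∧≤ᵇ D (suc k))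
  where
  open Equivalence
  γ≤ : ∀ D → T (isDominating (P _) D) → suc k ≤ ∣ D ∣
  γ≤ D dom = ≤-trans (k<[4+3k]/3 k)
    (required≤budget dominated D ∣ D ∣ (from (T-dominatesWithin D ∣ D ∣) (dom , ≤-refl)))
  W : Subset (2 + k * 3)
  W = true ∷ thirds k
  W-dom : T (isDominating (P _) W)
  W-dom = proj₁ (to (T-dominatesWithin W (suc k)) (thirds-dominates k))
  W≤γ : ∣ W ∣ ≤ suc k
  W≤γ = proj₂ (to (T-dominatesWithin W (suc k)) (thirds-dominates k))

gammaSets-P : ∀ k → gammaSets (P (2 + k * 3)) ≡ γWords k
gammaSets-P k = trans (filterᵇ-cong (isGammaSet-P k) (allSubsets _)) (solutions-γWords k)

-- How many γ-sets contain a vertex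

countAt : ℕ → List (Vec Bool n) → ℕ
countAt p ws = length (filterᵇ (_! p) ws)

countAt-map : ∀ p (f : Vec Bool m → Vec Bool n) (ws : List (Vec Bool m)) →
  countAt p (map f ws) ≡ length (filterᵇ (λ w → f w ! p) ws)
countAt-map p f ws = trans (cong length (filterᵇ-map (_! p) f ws)) (length-map f (filterᵇ (λ w → f w ! p) ws))

thirds-hit : ∀ {k q} → q ≤ k → T ((true ∷ thirds k) ! (q * 3))
thirds-hit {q = zero}          _         = tt
thirds-hit {suc k} {suc q} (s≤s q≤k) = thirds-hit q≤k

thirds-miss₁ : ∀ k q → ¬ T ((true ∷ thirds k) ! (1 + q * 3))
thirds-miss₁ zero    zero    ()
thirds-miss₁ zero    (suc q) ()
thirds-miss₁ (suc k) zero    ()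
thirds-miss₁ (suc k) (suc q) = thirds-miss₁ k q

thirds-miss₂ : ∀ k q → ¬ T ((true ∷ thirds k) ! (2 + q * 3))
thirds-miss₂ zero    q       ()
thirds-miss₂ (suc k) zero    ()
thirds-miss₂ (suc k) (suc q) = thirds-miss₂ k q

γWords-suc-hit : ∀ k p → T ((true ∷ thirds k) ! p) →
  countAt (3 + p) (γWords (suc k)) ≡ suc (countAt p (γWords k))
γWords-suc-hit k p hit = trans
  (cong length (filter-accept (T? ∘ (_! (3 + p))) {true ∷ thirds (suc k)} {map prefix010 (γWords k)} hit))
  (cong suc (countAt-map (3 + p) prefix010 (γWords k)))

γWords-suc-miss : ∀ k p → ¬ T ((true ∷ thirds k) ! p) →
  countAt (3 + p) (γWords (suc k)) ≡ countAt p (γWords k)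
γWords-suc-miss k p ¬hit = trans
  (cong length (filter-reject (T? ∘ (_! (3 + p))) {true ∷ thirds (suc k)} {map prefix010 (γWords k)} ¬hit))
  (countAt-map (3 + p) prefix010 (γWords k))

γWords-count₀ : ∀ k q → q ≤ k → countAt (q * 3) (γWords k) ≡ suc q
γWords-count₀ zero    zero    _         = refl
γWords-count₀ (suc k) zero    _         =
  cong suc (trans (countAt-map 0 prefix010 (γWords k)) (cong length (filterᵇ-false (γWords k))))
γWords-count₀ (suc k) (suc q) (s≤s q≤k) =
  trans (γWords-suc-hit k (q * 3) (thirds-hit q≤k)) (cong suc (γWords-count₀ k q q≤k))

γWords-count₁ : ∀ k q → countAt (1 + q * 3) (γWords k) ≡ suc k ∸ q
γWords-count₁ zero    zero    = refl
γWords-count₁ zero    (suc q) = sym (0∸n≡0 q)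
γWords-count₁ (suc k) zero    =
  trans (countAt-map 1 prefix010 (γWords k)) (trans (cong length (filterᵇ-true (γWords k))) (length-γWords k))
γWords-count₁ (suc k) (suc q) =
  trans (γWords-suc-miss k (1 + q * 3) (thirds-miss₁ k q)) (γWords-count₁ k q)

γWords-count₂ : ∀ k q → countAt (2 + q * 3) (γWords k) ≡ 0
γWords-count₂ zero    q       = refl
γWords-count₂ (suc k) zero    = trans (countAt-map 2 prefix010 (γWords k)) (cong length (filterᵇ-false (γWords k)))
γWords-count₂ (suc k) (suc q) =
  trans (γWords-suc-miss k (2 + q * 3) (thirds-miss₂ k q)) (γWords-count₂ k q)

τ-P : ∀ k → τ (P (2 + k * 3)) ≡ k + 2
τ-P k = trans (cong length (gammaSets-P k)) (trans (length-γWords k) (+-comm 2 k))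

DV-P : ∀ k (i : Fin (2 + k * 3)) → DV (P (2 + k * 3)) i ≡ countAt (toℕ i) (γWords k)
DV-P k i = trans (cong (length ∘ filterᵇ (λ D → lookup D i)) (gammaSets-P k))
                 (cong length (filterᵇ-cong (λ D → lookup-! D i) (γWords k)))

[m+q*n]/n≡q : ∀ {m n} q .{{_ : NonZero n}} → m < n → (m + q * n) / n ≡ q
[m+q*n]/n≡q {m} {n} q m<n =
  trans (+-distrib-/-∣ʳ m (divides-refl q)) (cong₂ _+_ (m<n⇒m/n≡0 m<n) (m*n/n≡m q n))

DV-P-by-residue : ∀ k (i : Fin (2 + k * 3)) →
  (suc (toℕ i) % 3 ≡ 0 → DV (P (2 + k * 3)) i ≡ 0) ×
  (suc (toℕ i) % 3 ≡ 1 → DV (P (2 + k * 3)) i ≡ 1 + suc (toℕ i) / 3) ×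
  (suc (toℕ i) % 3 ≡ 2 → DV (P (2 + k * 3)) i ≡ k + 1 ∸ suc (toℕ i) / 3)
-- Vertex i has label v = suc (toℕ i); toℕ i = r + q * 3 gives v ≡ r + 1 (mod 3), and v / 3 = q for r < 2.
DV-P-by-residue k i with toℕ i | DV-P k i | toℕ<n i
... | p | dv | p< with p divMod 3
... | result q zero refl =
  (λ h → contradiction (trans (sym v%3) h) λ ()) ,
  (λ _ → trans dv (trans (γWords-count₀ k q q≤k) (cong suc (sym v/3)))) ,
  (λ h → contradiction (trans (sym v%3) h) λ ())
  where
  v%3 : suc (q * 3) % 3 ≡ 1
  v%3 = [m+kn]%n≡m%n 1 q 3
  v/3 : suc (q * 3) / 3 ≡ q
  v/3 = [m+q*n]/n≡q q (s≤s (s≤s z≤n))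
  q≤k : q ≤ k
  q≤k = s≤s⁻¹ (*-cancelʳ-< 3 q (suc k) (<-≤-trans p< (n≤1+n _)))
... | result q (suc zero) refl =
  (λ h → contradiction (trans (sym v%3) h) λ ()) ,
  (λ h → contradiction (trans (sym v%3) h) λ ()) ,
  (λ _ → trans dv (trans (γWords-count₁ k q) (cong₂ _∸_ (+-comm 1 k) (sym v/3))))
  where
  v%3 : suc (suc (q * 3)) % 3 ≡ 2
  v%3 = [m+kn]%n≡m%n 2 q 3
  v/3 : suc (suc (q * 3)) / 3 ≡ q
  v/3 = [m+q*n]/n≡q q (s≤s (s≤s (s≤s z≤n)))
... | result q (suc (suc zero)) refl =
  (λ _ → trans dv (γWords-count₂ k q)) ,
  (λ h → contradiction (trans (sym v%3) h) λ ()) ,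
  (λ h → contradiction (trans (sym v%3) h) λ ())
  where
  v%3 : (3 + q * 3) % 3 ≡ 0
  v%3 = [m+kn]%n≡m%n 3 q 3

proposition5p4 : (k : ℕ) →
    (τ (P (3 * k + 2)) ≡ k + 2) ×
    ((i : Fin (3 * k + 2)) →
      ((suc (toℕ i) % 3 ≡ 0 → DV (P (3 * k + 2)) i ≡ 0) ×
       (suc (toℕ i) % 3 ≡ 1 → DV (P (3 * k + 2)) i ≡ 1 + suc (toℕ i) / 3) ×
       (suc (toℕ i) % 3 ≡ 2 → DV (P (3 * k + 2)) i ≡ k + 1 ∸ suc (toℕ i) / 3)))
proposition5p4 k rewrite trans (+-comm (3 * k) 2) (cong (2 +_) (*-comm 3 k)) = τ-P k , DV-P-by-residue k
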